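{- Let $k\ge1$ and $\mathbf c=\mathbf c^{(0)}\oplus(3)\oplus\mathbf c^{(1)}\oplus(3)\oplus\cdots\oplus(3)\oplus\mathbf c^{(k)}$ for compositions $\mathbf c^{(0)},\dots,\mathbf c^{(k)}$ with $\mathbf c^{(k)}\ne\epsilon$. Suppose there exists a composition $\mathbf b$ such that either (1) $|\mathbf b|=|\mathbf c^{(i)}|$ for some $1\le i\le k-1$ and $\mathrm P((2)\oplus\mathbf c^{(i)}\oplus(1))<\mathrm P((2)\oplus\mathbf b\oplus(1))$, or (2) $|\mathbf b|=|\mathbf c^{(k)}|$ and $\mathrm P((2)\oplus\mathbf c^{(k)})<\mathrm P((2)\oplus\mathbf b)$. Then $\mathbf c$ is not maximal.
   Context: Permutations $\sigma\in\mathcal S_n$ are words $\sigma_1\cdots\sigma_n$; $i$ is a peak if $\sigma_{i-1}<\sigma_i>\sigma_{i+1}$. A composition of $n$ is a finite sequence of positive integers summing to $n$; $|\mathbf c|$ is its size; $\epsilon$ is the empty composition. If the peak set of $\sigma\in\mathcal S_n$ is $\{i_1<\dots<i_k\}$, its peak-composition is $(c_1,\dots,c_{k+1})$, $c_j=i_j-i_{j-1}$, $i_0=0$, $i_{k+1}=n$. $\mathrm P(\mathbf c)$ is the number of $\sigma\in\mathcal S_{|\mathbf c|}$ with peak-composition $\mathbf c$; $\mathbf c$ is maximal if $\mathrm P(\mathbf b')\le\mathrm P(\mathbf c)$ for every composition $\mathbf b'$ of the same size. $\oplus$ denotes concatenation, with $\epsilon$ as identity. -}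

module Defs where

open import Data.Nat using (ℕ; zero; suc; _+_; _<ᵇ_; _≡ᵇ_; _<_; _∸_)
open import Data.Bool using (Bool; true; false; _∧_; if_then_else_)
open import Data.Nat.ListAction using (sum)
open import Data.List using (List; []; _∷_; _++_; length; concatMap; map; filter; downFrom; reverse)
open import Data.List.Relation.Unary.All using (All)
open import Data.Vec using (Vec; []; _∷_)
open import Relation.Binary.PropositionalEquality using (_≡_)
open import Relation.Nullary.Decidable using (Dec; yes; no)
import Data.List.Properties as LP
import Data.Nat.Properties as NP

IsComposition : List ℕ → Set
IsComposition c = All (0 <_) c

size : List ℕ → ℕ
size = sum

ε : List ℕ
ε = []

_⊕_ : List ℕ → List ℕ → List ℕ
_⊕_ = _++_
infixr 5 _⊕_

-- Permutations of {1,…,n} as words σ₁⋯σₙ.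
-- All ways to insert x into a word.
insertions : ℕ → List ℕ → List (List ℕ)
insertions x [] = (x ∷ []) ∷ []
insertions x (y ∷ ys) = (x ∷ y ∷ ys) ∷ map (y ∷_) (insertions x ys)

perms : ℕ → List (List ℕ)
perms zero = [] ∷ []
perms (suc n) = concatMap (insertions (suc n)) (perms n)

-- Peaks: positions i (1-indexed) with σ_{i-1} < σ_i > σ_{i+1}.
-- peaksFrom i w : peak positions of the word, where the head of w is
-- at position i and has predecessor p.
peaksAux : ℕ → ℕ → List ℕ → List ℕ
peaksAux i p [] = []
peaksAux i p (x ∷ []) = []
peaksAux i p (x ∷ y ∷ ws) =
  if (p <ᵇ x) ∧ (y <ᵇ x) then i ∷ peaksAux (suc i) x (y ∷ ws)
  else peaksAux (suc i) x (y ∷ ws)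

peakSet : List ℕ → List ℕ
peakSet [] = []
peakSet (x ∷ ws) = peaksAux 2 x ws

-- differences with i₀ = 0 and final endpoint n
diffs : ℕ → List ℕ → ℕ → List ℕ
diffs prev [] n = (n ∸ prev) ∷ []
diffs prev (i ∷ is) n = (i ∸ prev) ∷ diffs i is n

peakComposition : List ℕ → List ℕ
peakComposition σ = diffs 0 (peakSet σ) (length σ)

eqList : List ℕ → List ℕ → Bool
eqList [] [] = true
eqList [] (_ ∷ _) = false
eqList (_ ∷ _) [] = false
eqList (x ∷ xs) (y ∷ ys) = (x ≡ᵇ y) ∧ eqList xs ys

P : List ℕ → ℕ
P c = length (filter (λ σ → Data.Bool._≟_ (eqList (peakComposition σ) c) true) (perms (size c)))
  where import Data.Bool

IsMaximal : List ℕ → Set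
IsMaximal c = ∀ b' → IsComposition b' → size b' ≡ size c → Data.Nat._≤_ (P b') (P c)
  where import Data.Nat

join3 : ∀ {m} → Vec (List ℕ) (suc m) → List ℕ
join3 (c ∷ []) = c
join3 (c ∷ d ∷ ds) = c ⊕ (3 ∷ []) ⊕ join3 (d ∷ ds)

module Submission where

-- The heart of the proof is the product formula (P-product): for compositions
-- x and y ≠ ε,
--     P(x ⊕ (3) ⊕ y) = binom(|x|+3+|y|, |x|+1) · P(x ⊕ (1)) · P((2) ⊕ y).
-- It rests on two facts.
--  * Splitting (peakComposition-split⇒/⇐): a word u·v with |u| = |x|+1 has peak
--    composition x ⊕ (3) ⊕ y iff u has x ⊕ (1) and v has (2) ⊕ y.  We encode a
--    peak composition by its "cut marks" (position 0 and the peaks); the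
--    marks of u·v are those of u and v glued with two junction marks, which
--    vanish because peaks are never adjacent.
--  * Shuffling (shuffle): for statistics f, g that only see the relative order
--    of neighbouring letters, Σ_{σ ∈ Sₙ} f(σ₁…σₘ)·g(σₘ₊₁…σₙ) =
--    binom(n,m)·(Σ_{Sₘ} f)·(Σ_{Sₙ₋ₘ} g), proved by induction through the
--    insertion of the largest letter, which is how Defs enumerates Sₙ.
-- Replacing a block of c by b therefore multiplies P by the same factor,
-- which is positive because P of a maximal composition is at least P((n)) ≥ 1;
-- so the improved block yields a composition with strictly larger P.

open import Defs
open import Data.Bool using (Bool; true; false; _∧_; if_then_else_; T)
open import Data.Bool.Properties using (⇔→≡; ∧-identityʳ)
open import Data.Empty using (⊥; ⊥-elim)
open import Data.Fin using (Fin; toℕ; fromℕ; zero; suc)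
open import Data.List using (List; []; _∷_; _++_; length; map; concatMap; filter; take; drop)
open import Data.List.Properties using (++-assoc; ∷-injective; ∷-injectiveʳ; length-++; map-∘; take++drop≡id; length-take; length-drop; take-all; drop-all)
open import Data.List.Relation.Unary.All using (All; []; _∷_)
import Data.List.Relation.Unary.All as All
import Data.List.Relation.Unary.All.Properties as AllP
open import Data.List.Relation.Unary.Linked as Linked using (Linked; []; [-]; _∷_)
open import Data.Nat
open import Data.Nat.Properties
open import Data.Nat.Combinatorics using (_C_; nCn≡1; nCk+nC[k+1]≡[n+1]C[k+1])
open import Data.Nat.ListAction using (sum)
open import Data.Nat.ListAction.Properties using (sum-++)
open import Data.Nat.Solver using (module +-*-Solver)
open import Data.Product using (Σ; _×_; _,_; uncurry)
open import Data.Sum using (_⊎_; inj₁; inj₂)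
open import Data.Unit using (tt)
open import Data.Vec using (Vec; lookup; []; _∷_)
open import Function.Bundles using (_⇔_; mk⇔; module Equivalence)
open import Relation.Binary.PropositionalEquality
open import Relation.Nullary using (¬_)
open +-*-Solver using (solve; _:+_; _:*_; _:=_)

<ᵇ-true⇒< : ∀ {m n} → (m <ᵇ n) ≡ true → m < n
<ᵇ-true⇒< {m} {n} e = <ᵇ⇒< m n (subst T (sym e) tt)

<⇒<ᵇ-true : ∀ {m n} → m < n → (m <ᵇ n) ≡ true
<⇒<ᵇ-true {m} {n} m<n with m <ᵇ n in e
... | true = refl
... | false = ⊥-elim (subst T e (<⇒<ᵇ m<n))

<ᵇ-asym : ∀ {m n} → (m <ᵇ n) ≡ true → (n <ᵇ m) ≡ false
<ᵇ-asym {m} {n} m<n with n <ᵇ m in n<m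
... | false = refl
... | true = ⊥-elim (<-asym (<ᵇ-true⇒< {m} {n} m<n) (<ᵇ-true⇒< {n} {m} n<m))

<⇒>ᵇ-false : ∀ {m n} → m < n → (n <ᵇ m) ≡ false
<⇒>ᵇ-false {m} {n} m<n = <ᵇ-asym {m} {n} (<⇒<ᵇ-true m<n)

isPeak : ℕ → ℕ → ℕ → Bool
isPeak p x y = (p <ᵇ x) ∧ (y <ᵇ x)

peakMarks : ℕ → List ℕ → List Bool
peakMarks p [] = []
peakMarks p (x ∷ []) = []
peakMarks p (x ∷ y ∷ ws) = isPeak p x y ∷ peakMarks x (y ∷ ws)

-- Peak marks of the positions 1, …, n-1 of the word a ∷ ws (position 1 is never a peak).
marks : ℕ → List ℕ → List Bool
marks a [] = []
marks a (b ∷ ws) = false ∷ peakMarks a (b ∷ ws)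

cuts : ℕ → List ℕ → List Bool
cuts a ws = true ∷ marks a ws

runs : ℕ → List Bool → List ℕ
runs k [] = k ∷ []
runs k (true ∷ bs) = k ∷ runs 1 bs
runs k (false ∷ bs) = runs (suc k) bs

diffs-peaks : ∀ i prev p x ws → prev ≤ i →
  diffs prev (peaksAux i p (x ∷ ws)) (i + length ws) ≡ runs (i ∸ prev) (peakMarks p (x ∷ ws))
diffs-peaks i prev p x [] _ = cong (λ n → (n ∸ prev) ∷ []) (+-identityʳ i)
diffs-peaks i prev p x (y ∷ ws) prev≤i with isPeak p x y
... | true = cong ((i ∸ prev) ∷_) (begin
    diffs i (peaksAux (suc i) x (y ∷ ws)) (i + suc (length ws))
      ≡⟨ cong (diffs i (peaksAux (suc i) x (y ∷ ws))) (+-suc i (length ws)) ⟩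
    diffs i (peaksAux (suc i) x (y ∷ ws)) (suc i + length ws)
      ≡⟨ diffs-peaks (suc i) i x y ws (n≤1+n i) ⟩
    runs (suc i ∸ i) (peakMarks x (y ∷ ws))
      ≡⟨ cong (λ k → runs k (peakMarks x (y ∷ ws))) (m+n∸n≡m 1 i) ⟩
    runs 1 (peakMarks x (y ∷ ws)) ∎)
  where open ≡-Reasoning
... | false = begin
    diffs prev (peaksAux (suc i) x (y ∷ ws)) (i + suc (length ws))
      ≡⟨ cong (diffs prev (peaksAux (suc i) x (y ∷ ws))) (+-suc i (length ws)) ⟩
    diffs prev (peaksAux (suc i) x (y ∷ ws)) (suc i + length ws)
      ≡⟨ diffs-peaks (suc i) prev x y ws (≤-trans prev≤i (n≤1+n i)) ⟩
    runs (suc i ∸ prev) (peakMarks x (y ∷ ws))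
      ≡⟨ cong (λ k → runs k (peakMarks x (y ∷ ws))) (+-∸-assoc 1 prev≤i) ⟩
    runs (suc (i ∸ prev)) (peakMarks x (y ∷ ws)) ∎
  where open ≡-Reasoning

peakComposition-runs : ∀ a ws → peakComposition (a ∷ ws) ≡ runs 1 (marks a ws)
peakComposition-runs a [] = refl
peakComposition-runs a (b ∷ ws) = diffs-peaks 2 0 a b ws z≤n

falses : ℕ → List Bool → List Bool
falses zero bs = bs
falses (suc n) bs = falses n (false ∷ bs)

encode : List ℕ → List Bool
encode [] = []
encode (c ∷ cs) = true ∷ falses (c ∸ 1) (encode cs)

falses-++ : ∀ n bs ds → falses n bs ++ ds ≡ falses n (bs ++ ds)
falses-++ zero bs ds = refl
falses-++ (suc n) bs ds = falses-++ n (false ∷ bs) ds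

length-falses : ∀ n bs → length (falses n bs) ≡ n + length bs
length-falses zero bs = refl
length-falses (suc n) bs = trans (length-falses n (false ∷ bs)) (+-suc n (length bs))

runs-falses : ∀ n k bs → runs k (falses n bs) ≡ runs (n + k) bs
runs-falses zero k bs = refl
runs-falses (suc n) k bs = runs-falses n k (false ∷ bs)

encode-++ : ∀ x y → encode (x ++ y) ≡ encode x ++ encode y
encode-++ [] y = refl
encode-++ (c ∷ x) y = cong (true ∷_) (begin
    falses (c ∸ 1) (encode (x ++ y))     ≡⟨ cong (falses (c ∸ 1)) (encode-++ x y) ⟩
    falses (c ∸ 1) (encode x ++ encode y) ≡⟨ sym (falses-++ (c ∸ 1) (encode x) (encode y)) ⟩
    falses (c ∸ 1) (encode x) ++ encode y ∎)
  where open ≡-Reasoning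

length-encode : ∀ {c} → IsComposition c → length (encode c) ≡ size c
length-encode [] = refl
length-encode {c ∷ cs} (0<c ∷ cs-comp) = begin
    suc (length (falses (c ∸ 1) (encode cs))) ≡⟨ cong suc (length-falses (c ∸ 1) (encode cs)) ⟩
    suc (c ∸ 1 + length (encode cs))          ≡⟨ cong₂ _+_ (m+[n∸m]≡n 0<c) (length-encode cs-comp) ⟩
    c + size cs ∎
  where open ≡-Reasoning

encode-runs : ∀ k bs → encode (runs (suc k) bs) ≡ true ∷ falses k bs
encode-runs k [] = refl
encode-runs k (true ∷ bs) = cong (λ t → true ∷ falses k t) (encode-runs 0 bs)
encode-runs k (false ∷ bs) = encode-runs (suc k) bs

runs-encode : ∀ k {cs} → IsComposition cs → runs k (encode cs) ≡ k ∷ cs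
runs-encode k [] = refl
runs-encode k {c ∷ cs} (0<c ∷ cs-comp) = cong (k ∷_) (begin
    runs 1 (falses (c ∸ 1) (encode cs)) ≡⟨ runs-falses (c ∸ 1) 1 (encode cs) ⟩
    runs (c ∸ 1 + 1) (encode cs)        ≡⟨ cong (λ n → runs n (encode cs)) (m∸n+n≡m 0<c) ⟩
    runs c (encode cs)                  ≡⟨ runs-encode c cs-comp ⟩
    c ∷ cs ∎)
  where open ≡-Reasoning

cuts-of-peakComposition : ∀ a ws {c} → peakComposition (a ∷ ws) ≡ c → cuts a ws ≡ encode c
cuts-of-peakComposition a ws refl =
  sym (trans (cong encode (peakComposition-runs a ws)) (encode-runs 0 (marks a ws)))

peakComposition-of-cuts : ∀ a ws {c} → IsComposition c → cuts a ws ≡ encode c → peakComposition (a ∷ ws) ≡ c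
peakComposition-of-cuts a ws {c} c-comp e = ∷-injectiveʳ (begin
    0 ∷ peakComposition (a ∷ ws) ≡⟨ cong (0 ∷_) (peakComposition-runs a ws) ⟩
    runs 0 (cuts a ws)           ≡⟨ cong (runs 0) e ⟩
    runs 0 (encode c)            ≡⟨ runs-encode 0 c-comp ⟩
    0 ∷ c ∎)
  where open ≡-Reasoning

NotBoth : Bool → Bool → Set
NotBoth a b = a ∧ b ≡ false

not-both : ∀ a b c d → (b ≡ true → c ≡ false) → NotBoth (a ∧ b) (c ∧ d)
not-both false b c d _ = refl
not-both true false c d _ = refl
not-both true true c d b⇒¬c rewrite b⇒¬c refl = refl

-- Two neighbouring letters are never both peaks (the first is above the second).
peakMarks-separated : ∀ p x ws → Linked NotBoth (peakMarks p (x ∷ ws))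
peakMarks-separated p x [] = []
peakMarks-separated p x (y ∷ []) = [-]
peakMarks-separated p x (y ∷ z ∷ ws) =
  not-both (p <ᵇ x) (y <ᵇ x) (x <ᵇ y) (z <ᵇ y) (<ᵇ-asym {y} {x}) ∷ peakMarks-separated x y (z ∷ ws)

-- Position 1 is never a peak, so the mark at position 0 also has a blank neighbour.
cuts-separated : ∀ a ws → Linked NotBoth (cuts a ws)
cuts-separated a [] = [-]
cuts-separated a (b ∷ ws) = refl ∷ false∷ (peakMarks-separated a b ws)
  where
  false∷ : ∀ {bs} → Linked NotBoth bs → Linked NotBoth (false ∷ bs)
  false∷ [] = [-]
  false∷ [-] = refl ∷ [-]
  false∷ (r ∷ rs) = refl ∷ r ∷ rs

linked-suffix : ∀ {R : Bool → Bool → Set} xs {ys} → Linked R (xs ++ ys) → Linked R ys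
linked-suffix [] l = l
linked-suffix (x ∷ xs) l = linked-suffix xs (Linked.tail l)

peakMarks-junction : ∀ p x ws b₁ b₂ vs → Σ Bool λ α → Σ Bool λ β →
  peakMarks p (x ∷ ws ++ b₁ ∷ b₂ ∷ vs) ≡ peakMarks p (x ∷ ws) ++ α ∷ β ∷ peakMarks b₁ (b₂ ∷ vs)
peakMarks-junction p x [] b₁ b₂ vs = isPeak p x b₁ , isPeak x b₁ b₂ , refl
peakMarks-junction p x (w ∷ ws) b₁ b₂ vs with peakMarks-junction x w ws b₁ b₂ vs
... | α , β , e = α , β , cong (isPeak p x w ∷_) e

cuts-junction : ∀ a us b₁ b₂ vs → Σ Bool λ α → Σ Bool λ β →
  cuts a (us ++ b₁ ∷ b₂ ∷ vs) ≡ cuts a us ++ α ∷ β ∷ peakMarks b₁ (b₂ ∷ vs)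
cuts-junction a [] b₁ b₂ vs = false , isPeak a b₁ b₂ , refl
cuts-junction a (x ∷ ws) b₁ b₂ vs with peakMarks-junction a x ws b₁ b₂ vs
... | α , β , e = α , β , cong (λ t → true ∷ false ∷ t) e

length-cuts : ∀ a ws → length (cuts a ws) ≡ suc (length ws)
length-cuts a [] = refl
length-cuts a (b ∷ ws) = cong (λ n → suc (suc n)) (length-peakMarks a b ws)
  where
  length-peakMarks : ∀ p x ws → length (peakMarks p (x ∷ ws)) ≡ length ws
  length-peakMarks p x [] = refl
  length-peakMarks p x (y ∷ ws) = cong suc (length-peakMarks x y ws)

++-split : ∀ {A : Set} (xs xs' : List A) {ys ys'} → length xs ≡ length xs' →
           xs ++ ys ≡ xs' ++ ys' → xs ≡ xs' × ys ≡ ys'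
++-split [] [] _ e = refl , e
++-split (x ∷ xs) (x' ∷ xs') |xs| e with ∷-injective e
... | refl , e' with ++-split xs xs' (suc-injective |xs|) e'
... | refl , ys≡ys' = refl , ys≡ys'

encode-starts-marked : ∀ {y} → y ≢ [] → Σ (List Bool) λ r → encode y ≡ true ∷ r
encode-starts-marked {[]} y≢[] = ⊥-elim (y≢[] refl)
encode-starts-marked {c ∷ cs} _ = falses (c ∸ 1) (encode cs) , refl

module _ {x y : List ℕ} (x-comp : IsComposition x) (y-comp : IsComposition y) where

  private
    x1-comp : IsComposition (x ++ 1 ∷ [])
    x1-comp = AllP.++⁺ x-comp (s≤s z≤n ∷ [])

    x3y-comp : IsComposition (x ++ 3 ∷ y)
    x3y-comp = AllP.++⁺ x-comp (s≤s z≤n ∷ y-comp)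

    encode-x1 : encode (x ++ 1 ∷ []) ≡ encode x ++ true ∷ []
    encode-x1 = encode-++ x (1 ∷ [])

    encode-x3y : encode (x ++ 3 ∷ y) ≡ encode x ++ true ∷ false ∷ false ∷ encode y
    encode-x3y = encode-++ x (3 ∷ y)

  peakComposition-split⇒ : ∀ a us b₁ b₂ vs → length us ≡ size x →
    peakComposition (a ∷ us ++ b₁ ∷ b₂ ∷ vs) ≡ x ++ 3 ∷ y →
    peakComposition (a ∷ us) ≡ x ++ 1 ∷ [] × peakComposition (b₁ ∷ b₂ ∷ vs) ≡ 2 ∷ y
  peakComposition-split⇒ a us b₁ b₂ vs |us| e with cuts-junction a us b₁ b₂ vs
  ... | α , β , junction with ++-split (cuts a us) (encode x ++ true ∷ []) same-length glued
    where
    same-length : length (cuts a us) ≡ length (encode x ++ true ∷ [])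
    same-length = begin
      length (cuts a us)               ≡⟨ length-cuts a us ⟩
      suc (length us)                  ≡⟨ cong suc |us| ⟩
      suc (size x)                     ≡⟨ +-comm 1 (size x) ⟩
      size x + 1                       ≡⟨ cong (_+ 1) (sym (length-encode x-comp)) ⟩
      length (encode x) + 1            ≡⟨ sym (length-++ (encode x)) ⟩
      length (encode x ++ true ∷ []) ∎
      where open ≡-Reasoning
    glued : cuts a us ++ α ∷ β ∷ peakMarks b₁ (b₂ ∷ vs) ≡ (encode x ++ true ∷ []) ++ false ∷ false ∷ encode y
    glued = begin
      cuts a us ++ α ∷ β ∷ peakMarks b₁ (b₂ ∷ vs) ≡⟨ sym junction ⟩
      cuts a (us ++ b₁ ∷ b₂ ∷ vs)                 ≡⟨ cuts-of-peakComposition a _ e ⟩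
      encode (x ++ 3 ∷ y)                         ≡⟨ encode-x3y ⟩
      encode x ++ true ∷ false ∷ false ∷ encode y ≡⟨ sym (++-assoc (encode x) (true ∷ []) _) ⟩
      (encode x ++ true ∷ []) ++ false ∷ false ∷ encode y ∎
      where open ≡-Reasoning
  ... | left , right =
    peakComposition-of-cuts a us x1-comp (trans left (sym encode-x1)) ,
    peakComposition-of-cuts b₁ (b₂ ∷ vs) (s≤s z≤n ∷ y-comp)
      (cong (λ t → true ∷ false ∷ t) (∷-injectiveʳ (∷-injectiveʳ right)))

  -- Conversely, when y ≠ ε the junction marks are forced to be blanks.
  peakComposition-split⇐ : y ≢ [] → ∀ a us b₁ b₂ vs →
    peakComposition (a ∷ us) ≡ x ++ 1 ∷ [] → peakComposition (b₁ ∷ b₂ ∷ vs) ≡ 2 ∷ y →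
    peakComposition (a ∷ us ++ b₁ ∷ b₂ ∷ vs) ≡ x ++ 3 ∷ y
  peakComposition-split⇐ y≢[] a us b₁ b₂ vs eu ev with cuts-junction a us b₁ b₂ vs
  ... | α , β , junction =
    peakComposition-of-cuts a _ x3y-comp (begin
      cuts a (us ++ b₁ ∷ b₂ ∷ vs)                   ≡⟨ glued ⟩
      encode x ++ true ∷ α ∷ β ∷ encode y           ≡⟨ cong₂ (λ α β → encode x ++ true ∷ α ∷ β ∷ encode y) α≡false β≡false ⟩
      encode x ++ true ∷ false ∷ false ∷ encode y   ≡⟨ sym encode-x3y ⟩
      encode (x ++ 3 ∷ y) ∎)
    where
    open ≡-Reasoning
    tail-marks : peakMarks b₁ (b₂ ∷ vs) ≡ encode y
    tail-marks = ∷-injectiveʳ (∷-injectiveʳ (cuts-of-peakComposition b₁ (b₂ ∷ vs) ev))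
    glued : cuts a (us ++ b₁ ∷ b₂ ∷ vs) ≡ encode x ++ true ∷ α ∷ β ∷ encode y
    glued = begin
      cuts a (us ++ b₁ ∷ b₂ ∷ vs)                           ≡⟨ junction ⟩
      cuts a us ++ α ∷ β ∷ peakMarks b₁ (b₂ ∷ vs)           ≡⟨ cong₂ (λ l m → l ++ α ∷ β ∷ m) (cuts-of-peakComposition a us eu) tail-marks ⟩
      encode (x ++ 1 ∷ []) ++ α ∷ β ∷ encode y              ≡⟨ cong (_++ α ∷ β ∷ encode y) encode-x1 ⟩
      (encode x ++ true ∷ []) ++ α ∷ β ∷ encode y           ≡⟨ ++-assoc (encode x) (true ∷ []) _ ⟩
      encode x ++ true ∷ α ∷ β ∷ encode y ∎
    separated : Linked NotBoth (true ∷ α ∷ β ∷ encode y)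
    separated = linked-suffix (encode x) (subst (Linked NotBoth) glued (cuts-separated a _))
    α≡false : α ≡ false
    α≡false = Linked.head separated
    β≡false : β ≡ false
    β≡false with encode-starts-marked y≢[]
    ... | r , e = trans (sym (∧-identityʳ β))
      (Linked.head (Linked.tail (Linked.tail (subst (λ m → Linked NotBoth (true ∷ α ∷ β ∷ m)) e separated))))

indicator : Bool → ℕ
indicator b = if b then 1 else 0

indicator-∧ : ∀ a b → indicator (a ∧ b) ≡ indicator a * indicator b
indicator-∧ false b = refl
indicator-∧ true b = sym (+-identityʳ (indicator b))

hits : List ℕ → List ℕ → ℕ
hits c σ = indicator (eqList (peakComposition σ) c)

eqList-sound : ∀ a b → eqList a b ≡ true → a ≡ b
eqList-sound [] [] _ = refl
eqList-sound (m ∷ a) (n ∷ b) e with m ≡ᵇ n in m≡ᵇn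
... | true = cong₂ _∷_ (≡ᵇ⇒≡ m n (subst T (sym m≡ᵇn) tt)) (eqList-sound a b e)

eqList-complete : ∀ {a b} → a ≡ b → eqList a b ≡ true
eqList-complete {[]} refl = refl
eqList-complete {n ∷ a} refl = trans (cong ((n ≡ᵇ n) ∧_) (eqList-complete {a} refl)) (≡ᵇ-refl n)
  where
  ≡ᵇ-refl : ∀ n → (n ≡ᵇ n) ∧ true ≡ true
  ≡ᵇ-refl zero = refl
  ≡ᵇ-refl (suc n) = ≡ᵇ-refl n

hits-factor : ∀ {c c₁ c₂} u v →
  (peakComposition (u ++ v) ≡ c ⇔ (peakComposition u ≡ c₁ × peakComposition v ≡ c₂)) →
  hits c (u ++ v) ≡ hits c₁ u * hits c₂ v
hits-factor {c} {c₁} {c₂} u v iff =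
  trans (cong indicator (⇔→≡ (mk⇔ to from))) (indicator-∧ (eqList (peakComposition u) c₁) _)
  where
  open Equivalence iff renaming (to to split; from to join)
  to : eqList (peakComposition (u ++ v)) c ≡ true → eqList (peakComposition u) c₁ ∧ eqList (peakComposition v) c₂ ≡ true
  to e with split (eqList-sound _ _ e)
  ... | eu , ev rewrite eqList-complete eu = eqList-complete ev
  from : eqList (peakComposition u) c₁ ∧ eqList (peakComposition v) c₂ ≡ true → eqList (peakComposition (u ++ v)) c ≡ true
  from e with eqList (peakComposition u) c₁ in eu
  ... | true = eqList-complete (join (eqList-sound _ _ eu , eqList-sound _ _ e))

sumOver : {A : Set} → List A → (A → ℕ) → ℕ
sumOver [] f = 0
sumOver (a ∷ as) f = f a + sumOver as f

total : ℕ → (List ℕ → ℕ) → ℕ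
total n f = sumOver (perms n) f

P-as-sum : ∀ c {n} → size c ≡ n → P c ≡ total n (hits c)
P-as-sum c refl = count (perms (size c))
  where
  count : ∀ σs → length (filter (λ σ → Data.Bool._≟_ (eqList (peakComposition σ) c) true) σs) ≡ sumOver σs (hits c)
  count [] = refl
  count (σ ∷ σs) with eqList (peakComposition σ) c
  ... | true = cong suc (count σs)
  ... | false = count σs

sumOver-++ : {A : Set} (as bs : List A) (f : A → ℕ) → sumOver (as ++ bs) f ≡ sumOver as f + sumOver bs f
sumOver-++ [] bs f = refl
sumOver-++ (a ∷ as) bs f = trans (cong (f a +_) (sumOver-++ as bs f)) (sym (+-assoc (f a) _ _))

sumOver-*ˡ : {A : Set} (as : List A) (f : A → ℕ) (k : ℕ) → sumOver as (λ a → k * f a) ≡ k * sumOver as f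
sumOver-*ˡ [] f k = sym (*-zeroʳ k)
sumOver-*ˡ (a ∷ as) f k = trans (cong (k * f a +_) (sumOver-*ˡ as f k)) (sym (*-distribˡ-+ k (f a) _))

sumOver-*ʳ : {A : Set} (as : List A) (f : A → ℕ) (k : ℕ) → sumOver as (λ a → f a * k) ≡ sumOver as f * k
sumOver-*ʳ [] f k = refl
sumOver-*ʳ (a ∷ as) f k = trans (cong (f a * k +_) (sumOver-*ʳ as f k)) (sym (*-distribʳ-+ k (f a) _))

sumOver-+ : {A : Set} (as : List A) (f g : A → ℕ) → sumOver as (λ a → f a + g a) ≡ sumOver as f + sumOver as g
sumOver-+ [] f g = refl
sumOver-+ (a ∷ as) f g = trans (cong (f a + g a +_) (sumOver-+ as f g))
  (solve 4 (λ p q r s → (p :+ q) :+ (r :+ s) := (p :+ r) :+ (q :+ s)) refl (f a) (g a) (sumOver as f) (sumOver as g))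

sumOver-cong : ∀ {A : Set} {Q : A → Set} (as : List A) {f g : A → ℕ} → (∀ {a} → Q a → f a ≡ g a) → All Q as →
               sumOver as f ≡ sumOver as g
sumOver-cong [] _ [] = refl
sumOver-cong (a ∷ as) f≡g (pa ∷ pas) = cong₂ _+_ (f≡g pa) (sumOver-cong as f≡g pas)

sumOver-map : ∀ {A : Set} {B : Set} (h : A → B) (as : List A) (f : B → ℕ) → sumOver (map h as) f ≡ sumOver as (λ a → f (h a))
sumOver-map h [] f = refl
sumOver-map h (a ∷ as) f = cong (f (h a) +_) (sumOver-map h as f)

sumOver-concatMap : ∀ {A : Set} {B : Set} (h : A → List B) (as : List A) (f : B → ℕ) →
                    sumOver (concatMap h as) f ≡ sumOver as (λ a → sumOver (h a) f)
sumOver-concatMap h [] f = refl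
sumOver-concatMap h (a ∷ as) f = trans (sumOver-++ (h a) (concatMap h as) f) (cong (sumOver (h a) f +_) (sumOver-concatMap h as f))

all-concatMap : {A B : Set} {P : A → Set} {Q : B → Set} (h : A → List B) {as : List A} →
   (∀ {a} → P a → All Q (h a)) → All P as → All Q (concatMap h as)
all-concatMap h pq pas = AllP.concat⁺ (AllP.map⁺ (All.map pq pas))

insertions-length : ∀ b w → All (λ τ → length τ ≡ suc (length w)) (insertions b w)
insertions-length b [] = refl ∷ []
insertions-length b (y ∷ ys) = refl ∷ AllP.map⁺ (All.map (cong suc) (insertions-length b ys))

insertions-bounded : ∀ {n} b w → b < n → All (_< n) w → All (All (_< n)) (insertions b w)
insertions-bounded b [] b<n [] = (b<n ∷ []) ∷ []
insertions-bounded b (y ∷ ys) b<n (y<n ∷ ys<n) =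
  (b<n ∷ y<n ∷ ys<n) ∷ AllP.map⁺ (All.map (y<n ∷_) (insertions-bounded b ys b<n ys<n))

perms-length : ∀ n → All (λ σ → length σ ≡ n) (perms n)
perms-length zero = refl ∷ []
perms-length (suc n) = all-concatMap (insertions (suc n))
  (λ {π} |π| → subst (λ m → All (λ τ → length τ ≡ suc m) (insertions (suc n) π)) |π| (insertions-length (suc n) π))
  (perms-length n)

perms-bounded : ∀ n → All (All (_< suc n)) (perms n)
perms-bounded zero = [] ∷ []
perms-bounded (suc n) = all-concatMap (insertions (suc n))
  (λ {π} π<n → insertions-bounded (suc n) π ≤-refl (All.map (λ x<n → ≤-trans x<n (n≤1+n _)) π<n)) (perms-bounded n)

insertAt : ℕ → ℕ → List ℕ → List ℕ
insertAt zero b w = b ∷ w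
insertAt (suc j) b [] = b ∷ []
insertAt (suc j) b (x ∷ xs) = x ∷ insertAt j b xs

positions : ℕ → List ℕ
positions zero = []
positions (suc n) = 0 ∷ map suc (positions n)

insertions-positions : ∀ b w → insertions b w ≡ map (λ j → insertAt j b w) (positions (suc (length w)))
insertions-positions b [] = refl
insertions-positions b (y ∷ ys) = cong ((b ∷ y ∷ ys) ∷_) (begin
    map (y ∷_) (insertions b ys)                         ≡⟨ cong (map (y ∷_)) (insertions-positions b ys) ⟩
    map (y ∷_) (map (λ j → insertAt j b ys) js)          ≡⟨ sym (map-∘ js) ⟩
    map (λ j → insertAt (suc j) b (y ∷ ys)) js           ≡⟨ map-∘ js ⟩
    map (λ j → insertAt j b (y ∷ ys)) (map suc js) ∎)
  where
  open ≡-Reasoning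
  js = positions (suc (length ys))

data SameShape : List ℕ → List ℕ → Set where
  nil    : SameShape [] []
  single : ∀ x y → SameShape (x ∷ []) (y ∷ [])
  step   : ∀ {x y x₂ y₂ xs ys} → (x <ᵇ x₂) ≡ (y <ᵇ y₂) → (x₂ <ᵇ x) ≡ (y₂ <ᵇ y) →
           SameShape (x₂ ∷ xs) (y₂ ∷ ys) → SameShape (x ∷ x₂ ∷ xs) (y ∷ y₂ ∷ ys)

ShapeInvariant : (List ℕ → ℕ) → Set
ShapeInvariant f = ∀ {w w'} → SameShape w w' → f w ≡ f w'

sameShape-refl : ∀ w → SameShape w w
sameShape-refl [] = nil
sameShape-refl (x ∷ []) = single x x
sameShape-refl (x ∷ x₂ ∷ xs) = step refl refl (sameShape-refl (x₂ ∷ xs))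

sameShape-length : ∀ {w w'} → SameShape w w' → length w ≡ length w'
sameShape-length nil = refl
sameShape-length (single x y) = refl
sameShape-length (step _ _ r) = cong suc (sameShape-length r)

peakMarks-shape : ∀ {p p' ws ws'} → SameShape (p ∷ ws) (p' ∷ ws') → peakMarks p ws ≡ peakMarks p' ws'
peakMarks-shape (single _ _) = refl
peakMarks-shape (step _ _ (single _ _)) = refl
peakMarks-shape (step p<x x<p r@(step x<y y<x _)) = cong₂ _∷_ (cong₂ _∧_ p<x y<x) (peakMarks-shape r)

marks-shape : ∀ {a a' ws ws'} → SameShape (a ∷ ws) (a' ∷ ws') → marks a ws ≡ marks a' ws'
marks-shape (single _ _) = refl
marks-shape r@(step _ _ _) = cong (false ∷_) (peakMarks-shape r)

hits-shape : ∀ c → ShapeInvariant (hits c)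
hits-shape c r = cong (λ σ → indicator (eqList σ c)) (peakComposition-shape r)
  where
  peakComposition-shape : ∀ {w w'} → SameShape w w' → peakComposition w ≡ peakComposition w'
  peakComposition-shape nil = refl
  peakComposition-shape {a ∷ ws} {a' ∷ ws'} r@(single _ _) =
    trans (peakComposition-runs a ws) (trans (cong (runs 1) (marks-shape r)) (sym (peakComposition-runs a' ws')))
  peakComposition-shape {a ∷ ws} {a' ∷ ws'} r@(step _ _ _) =
    trans (peakComposition-runs a ws) (trans (cong (runs 1) (marks-shape r)) (sym (peakComposition-runs a' ws')))

<ᵇ-max-alike : ∀ {x y b b'} → x < b → y < b' → (x <ᵇ b) ≡ (y <ᵇ b')
<ᵇ-max-alike x<b y<b' = trans (<⇒<ᵇ-true x<b) (sym (<⇒<ᵇ-true y<b'))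

max-<ᵇ-alike : ∀ {x y b b'} → x < b → y < b' → (b <ᵇ x) ≡ (b' <ᵇ y)
max-<ᵇ-alike x<b y<b' = trans (<⇒>ᵇ-false x<b) (sym (<⇒>ᵇ-false y<b'))

sameShape-insertAt : ∀ j {w w' b b'} → SameShape w w' → All (_< b) w → All (_< b') w' →
                     SameShape (insertAt j b w) (insertAt j b' w')
sameShape-insertAt zero {b = b} {b'} nil _ _ = single b b'
sameShape-insertAt (suc j) {b = b} {b'} nil _ _ = single b b'
sameShape-insertAt zero r@(single _ _) (x<b ∷ _) (y<b' ∷ _) = step (max-<ᵇ-alike x<b y<b') (<ᵇ-max-alike x<b y<b') r
sameShape-insertAt zero r@(step _ _ _) (x<b ∷ _) (y<b' ∷ _) = step (max-<ᵇ-alike x<b y<b') (<ᵇ-max-alike x<b y<b') r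
sameShape-insertAt (suc zero) {b = b} {b'} (single _ _) (x<b ∷ _) (y<b' ∷ _) =
  step (<ᵇ-max-alike x<b y<b') (max-<ᵇ-alike x<b y<b') (single b b')
sameShape-insertAt (suc (suc j)) {b = b} {b'} (single _ _) (x<b ∷ _) (y<b' ∷ _) =
  step (<ᵇ-max-alike x<b y<b') (max-<ᵇ-alike x<b y<b') (single b b')
sameShape-insertAt (suc zero) (step _ _ r) (x<b ∷ xs<b) (y<b' ∷ ys<b') =
  step (<ᵇ-max-alike x<b y<b') (max-<ᵇ-alike x<b y<b') (sameShape-insertAt zero r xs<b ys<b')
sameShape-insertAt (suc (suc j)) (step x<x₂ x₂<x r) (_ ∷ xs<b) (_ ∷ ys<b') =
  step x<x₂ x₂<x (sameShape-insertAt (suc j) r xs<b ys<b')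

sumOver-insertions-shape : ∀ {f} → ShapeInvariant f → ∀ {w w' b b'} → SameShape w w' →
  All (_< b) w → All (_< b') w' → sumOver (insertions b w) f ≡ sumOver (insertions b' w') f
sumOver-insertions-shape {f} f-inv {w} {w'} {b} {b'} r w<b w'<b' = begin
  sumOver (insertions b w) f                                    ≡⟨ cong (λ l → sumOver l f) (insertions-positions b w) ⟩
  sumOver (map (λ j → insertAt j b w) (positions (suc (length w)))) f   ≡⟨ sumOver-map _ (positions (suc (length w))) f ⟩
  sumOver (positions (suc (length w))) (λ j → f (insertAt j b w))       ≡⟨ pointwise (positions (suc (length w))) ⟩
  sumOver (positions (suc (length w))) (λ j → f (insertAt j b' w'))     ≡⟨ cong (λ n → sumOver (positions (suc n)) (λ j → f (insertAt j b' w'))) (sameShape-length r) ⟩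
  sumOver (positions (suc (length w'))) (λ j → f (insertAt j b' w'))    ≡⟨ sumOver-map _ (positions (suc (length w'))) f ⟨
  sumOver (map (λ j → insertAt j b' w') (positions (suc (length w')))) f ≡⟨ cong (λ l → sumOver l f) (insertions-positions b' w') ⟨
  sumOver (insertions b' w') f ∎
  where
  open ≡-Reasoning
  pointwise : ∀ js → sumOver js (λ j → f (insertAt j b w)) ≡ sumOver js (λ j → f (insertAt j b' w'))
  pointwise [] = refl
  pointwise (j ∷ js) = cong₂ _+_ (f-inv (sameShape-insertAt j r w<b w'<b')) (pointwise js)

below-sum : ∀ t → All (_< suc (sum t)) t
below-sum [] = []
below-sum (x ∷ t) = s≤s (m≤m+n x (sum t)) ∷ All.map (λ y<s → ≤-trans y<s (s≤s (m≤n+m (sum t) x))) (below-sum t)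

extend : (List ℕ → ℕ) → List ℕ → ℕ
extend f t = sumOver (insertions (suc (sum t)) t) f

extend-any-bound : ∀ {f} → ShapeInvariant f → ∀ {b t} → All (_< b) t → sumOver (insertions b t) f ≡ extend f t
extend-any-bound f-inv {t = t} t<b = sumOver-insertions-shape f-inv (sameShape-refl t) t<b (below-sum t)

extend-shape : ∀ {f} → ShapeInvariant f → ShapeInvariant (extend f)
extend-shape f-inv {w} {w'} r = sumOver-insertions-shape f-inv r (below-sum w) (below-sum w')

total-suc : ∀ k {f} → ShapeInvariant f → total (suc k) f ≡ total k (extend f)
total-suc k {f} f-inv = trans (sumOver-concatMap (insertions (suc k)) (perms k) f)
  (sumOver-cong (perms k) (extend-any-bound f-inv) (perms-bounded k))

-- Cutting an insertion of b into π after m+1 letters: b lands either among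
-- the first m+1 letters or after them.
insertions-split : ∀ b (f g : List ℕ → ℕ) m π → suc m ≤ length π →
  sumOver (insertions b π) (λ σ → f (take (suc m) σ) * g (drop (suc m) σ)) ≡
  sumOver (insertions b (take m π)) f * g (drop m π) + f (take (suc m) π) * sumOver (insertions b (drop (suc m) π)) g
insertions-split b f g zero (y ∷ ys) _ = begin
  f (b ∷ []) * g (y ∷ ys) + sumOver (map (y ∷_) (insertions b ys)) (λ σ → f (take 1 σ) * g (drop 1 σ))
    ≡⟨ cong (f (b ∷ []) * g (y ∷ ys) +_) (trans (sumOver-map (y ∷_) (insertions b ys) _) (sumOver-*ˡ (insertions b ys) g (f (y ∷ [])))) ⟩
  f (b ∷ []) * g (y ∷ ys) + f (y ∷ []) * sumOver (insertions b ys) g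
    ≡⟨ cong (λ t → t * g (y ∷ ys) + f (y ∷ []) * sumOver (insertions b ys) g) (sym (+-identityʳ (f (b ∷ [])))) ⟩
  (f (b ∷ []) + 0) * g (y ∷ ys) + f (y ∷ []) * sumOver (insertions b ys) g ∎
  where open ≡-Reasoning
insertions-split b f g (suc m) (y ∷ ys) (s≤s m<|ys|) = begin
  F₁ * G₀ + sumOver (map (y ∷_) (insertions b ys)) (λ σ → f (take (2 + m) σ) * g (drop (2 + m) σ))
    ≡⟨ cong (F₁ * G₀ +_) (trans (sumOver-map (y ∷_) (insertions b ys) _) (insertions-split b (λ t → f (y ∷ t)) g m ys m<|ys|)) ⟩
  F₁ * G₀ + (F₂ * G₀ + F₃)
    ≡⟨ solve 4 (λ a b c g → a :* g :+ (b :* g :+ c) := (a :+ b) :* g :+ c) refl F₁ F₂ F₃ G₀ ⟩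
  (F₁ + F₂) * G₀ + F₃
    ≡⟨ cong (λ t → (F₁ + t) * G₀ + F₃) (sym (sumOver-map (y ∷_) (insertions b (take m ys)) f)) ⟩
  (F₁ + sumOver (map (y ∷_) (insertions b (take m ys))) f) * G₀ + F₃ ∎
  where
  open ≡-Reasoning
  F₁ = f (b ∷ y ∷ take m ys)
  G₀ = g (drop m ys)
  F₂ = sumOver (insertions b (take m ys)) (λ t → f (y ∷ t))
  F₃ = f (y ∷ take (suc m) ys) * sumOver (insertions b (drop (suc m) ys)) g

-- By induction on n: the largest letter lands in the first m or the last
-- n - m letters (insertions-split), and Pascal's rule adds up the two cases.
shuffle : ∀ n m → m ≤ n → ∀ {f g} → ShapeInvariant f → ShapeInvariant g →
  sumOver (perms n) (λ σ → f (take m σ) * g (drop m σ)) ≡ (n C m) * (total m f * total (n ∸ m) g)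
shuffle n zero _ {f} {g} _ _ = begin
  sumOver (perms n) (λ σ → f [] * g σ) ≡⟨ sumOver-*ˡ (perms n) g (f []) ⟩
  f [] * total n g                     ≡⟨ solve 2 (λ a t → a :* t := con 1 :* ((a :+ con 0) :* t)) refl (f []) (total n g) ⟩
  1 * ((f [] + 0) * total n g)        ≡⟨ cong (_* ((f [] + 0) * total n g)) (sym nC0≡1) ⟩
  (n C 0) * (total 0 f * total n g) ∎
  where
  open ≡-Reasoning
  open +-*-Solver using (con)
  nC0≡1 : n C 0 ≡ 1
  nC0≡1 = refl
shuffle (suc n) (suc m) (s≤s m≤n) {f} {g} f-inv g-inv with m≤n⇒m<n∨m≡n m≤n
... | inj₂ refl = begin
  sumOver (perms (suc n)) (λ σ → f (take (suc n) σ) * g (drop (suc n) σ))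
    ≡⟨ sumOver-cong (perms (suc n)) (λ {σ} |σ| → cong₂ (λ s t → f s * g t)
         (take-all (suc n) σ (≤-reflexive |σ|)) (drop-all (suc n) σ (≤-reflexive |σ|))) (perms-length (suc n)) ⟩
  sumOver (perms (suc n)) (λ σ → f σ * g [])      ≡⟨ sumOver-*ʳ (perms (suc n)) f (g []) ⟩
  total (suc n) f * g []                           ≡⟨ solve 2 (λ s t → s :* t := con 1 :* (s :* (t :+ con 0))) refl (total (suc n) f) (g []) ⟩
  1 * (total (suc n) f * total 0 g)                ≡⟨ cong₂ (λ c k → c * (total (suc n) f * total k g)) (sym (nCn≡1 (suc n))) (sym (n∸n≡0 n)) ⟩
  (suc n C suc n) * (total (suc n) f * total (n ∸ n) g) ∎
  where
  open ≡-Reasoning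
  open +-*-Solver using (con)
... | inj₁ m<n = begin
  sumOver (perms (suc n)) h
    ≡⟨ sumOver-concatMap (insertions (suc n)) (perms n) h ⟩
  sumOver (perms n) (λ π → sumOver (insertions (suc n) π) h)
    ≡⟨ sumOver-cong (perms n) split-insertion (All.zip (perms-length n , perms-bounded n)) ⟩
  sumOver (perms n) (λ π → extend f (take m π) * g (drop m π) + f (take (suc m) π) * extend g (drop (suc m) π))
    ≡⟨ sumOver-+ (perms n) _ _ ⟩
  sumOver (perms n) (λ π → extend f (take m π) * g (drop m π)) + sumOver (perms n) (λ π → f (take (suc m) π) * extend g (drop (suc m) π))
    ≡⟨ cong₂ _+_ (shuffle n m m≤n (extend-shape f-inv) g-inv) (shuffle n (suc m) m<n f-inv (extend-shape g-inv)) ⟩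
  (n C m) * (total m (extend f) * total (n ∸ m) g) + (n C suc m) * (total (suc m) f * total (n ∸ suc m) (extend g))
    ≡⟨ cong₂ (λ s t → (n C m) * (s * total (n ∸ m) g) + (n C suc m) * (total (suc m) f * t))
         (sym (total-suc m f-inv)) (trans (sym (total-suc (n ∸ suc m) g-inv)) (cong (λ k → total k g) (sym (+-∸-assoc 1 m<n)))) ⟩
  (n C m) * X + (n C suc m) * X
    ≡⟨ sym (*-distribʳ-+ X (n C m) (n C suc m)) ⟩
  (n C m + n C suc m) * X
    ≡⟨ cong (_* X) (nCk+nC[k+1]≡[n+1]C[k+1] n m) ⟩
  (suc n C suc m) * X ∎
  where
  open ≡-Reasoning
  h : List ℕ → ℕ
  h σ = f (take (suc m) σ) * g (drop (suc m) σ)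
  X = total (suc m) f * total (n ∸ m) g
  split-insertion : ∀ {π} → length π ≡ n × All (_< suc n) π →
    sumOver (insertions (suc n) π) h ≡ extend f (take m π) * g (drop m π) + f (take (suc m) π) * extend g (drop (suc m) π)
  split-insertion {π} (|π| , π<n) = trans (insertions-split (suc n) f g m π (≤-trans m<n (≤-reflexive (sym |π|))))
    (cong₂ (λ s t → s * g (drop m π) + f (take (suc m) π) * t)
       (extend-any-bound f-inv (AllP.take⁺ m π<n)) (extend-any-bound g-inv (AllP.drop⁺ (suc m) π<n)))

hits-junction : ∀ {x y} → IsComposition x → IsComposition y → y ≢ [] → ∀ u v →
  length u ≡ suc (size x) → length v ≡ suc (suc (size y)) →
  hits (x ++ 3 ∷ y) (u ++ v) ≡ hits (x ++ 1 ∷ []) u * hits (2 ∷ y) v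
hits-junction x-comp y-comp y≢[] (a ∷ us) (b₁ ∷ b₂ ∷ vs) |u| _ =
  hits-factor (a ∷ us) (b₁ ∷ b₂ ∷ vs) (mk⇔
    (peakComposition-split⇒ x-comp y-comp a us b₁ b₂ vs (suc-injective |u|))
    (uncurry (peakComposition-split⇐ x-comp y-comp y≢[] a us b₁ b₂ vs)))

P-product : ∀ {x y} → IsComposition x → IsComposition y → y ≢ [] →
  P (x ++ 3 ∷ y) ≡ ((size x + 3 + size y) C suc (size x)) * (P (x ++ 1 ∷ []) * P (2 ∷ y))
P-product {x} {y} x-comp y-comp y≢[] = begin
  P (x ++ 3 ∷ y)                ≡⟨ P-as-sum (x ++ 3 ∷ y) size-x3y ⟩
  total N (hits (x ++ 3 ∷ y))   ≡⟨ sumOver-cong {Q = λ σ → length σ ≡ N} (perms N) (λ {σ} → cut {σ}) (perms-length N) ⟩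
  sumOver (perms N) (λ σ → hits (x ++ 1 ∷ []) (take m σ) * hits (2 ∷ y) (drop m σ))
    ≡⟨ shuffle N m m≤N (hits-shape (x ++ 1 ∷ [])) (hits-shape (2 ∷ y)) ⟩
  (N C m) * (total m (hits (x ++ 1 ∷ [])) * total (N ∸ m) (hits (2 ∷ y)))
    ≡⟨ cong₂ (λ s t → (N C m) * (s * t)) (sym (P-as-sum (x ++ 1 ∷ []) size-x1)) (sym (P-as-sum (2 ∷ y) (sym N∸m))) ⟩
  (N C m) * (P (x ++ 1 ∷ []) * P (2 ∷ y)) ∎
  where
  open ≡-Reasoning
  open +-*-Solver using (con)
  N = size x + 3 + size y
  m = suc (size x)
  N≡m+ : N ≡ m + suc (suc (size y))
  N≡m+ = solve 2 (λ s t → s :+ con 3 :+ t := con 1 :+ s :+ (con 2 :+ t)) refl (size x) (size y)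
  m≤N : m ≤ N
  m≤N = subst (m ≤_) (sym N≡m+) (m≤m+n m _)
  N∸m : N ∸ m ≡ suc (suc (size y))
  N∸m = trans (cong (_∸ m) N≡m+) (m+n∸m≡n m _)
  size-x3y : size (x ++ 3 ∷ y) ≡ N
  size-x3y = trans (sum-++ x (3 ∷ y)) (sym (+-assoc (size x) 3 (size y)))
  size-x1 : size (x ++ 1 ∷ []) ≡ m
  size-x1 = trans (sum-++ x (1 ∷ [])) (+-comm (size x) 1)
  cut : ∀ {σ} → length σ ≡ N → hits (x ++ 3 ∷ y) σ ≡ hits (x ++ 1 ∷ []) (take m σ) * hits (2 ∷ y) (drop m σ)
  cut {σ} |σ| = trans (cong (hits (x ++ 3 ∷ y)) (sym (take++drop≡id m σ)))
    (hits-junction x-comp y-comp y≢[] (take m σ) (drop m σ)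
      (trans (length-take m σ) (trans (cong (m ⊓_) |σ|) (m≤n⇒m⊓n≡m m≤N)))
      (trans (length-drop m σ) (trans (cong (_∸ m) |σ|) N∸m)))

decreasing : ℕ → List ℕ
decreasing zero = []
decreasing (suc n) = suc n ∷ decreasing n

insertions-head : ∀ b w → Σ (List (List ℕ)) λ rest → insertions b w ≡ (b ∷ w) ∷ rest
insertions-head b [] = [] , refl
insertions-head b (y ∷ ys) = _ , refl

perms-head : ∀ n → Σ (List (List ℕ)) λ rest → perms n ≡ decreasing n ∷ rest
perms-head zero = [] , refl
perms-head (suc n) with perms-head n | insertions-head (suc n) (decreasing n)
... | rest , e | rest′ , e′ = rest′ ++ concatMap (insertions (suc n)) rest ,
  trans (cong (concatMap (insertions (suc n))) e) (cong (_++ concatMap (insertions (suc n)) rest) e′)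

decreasing-no-peaks : ∀ i j p → suc j < p → peaksAux i p (decreasing (suc j)) ≡ []
decreasing-no-peaks i zero p _ = refl
decreasing-no-peaks i (suc j) p j<p rewrite <⇒>ᵇ-false {suc (suc j)} {p} j<p =
  decreasing-no-peaks (suc i) j (suc (suc j)) ≤-refl

length-decreasing : ∀ n → length (decreasing n) ≡ n
length-decreasing zero = refl
length-decreasing (suc n) = cong suc (length-decreasing n)

peakComposition-decreasing : ∀ k → peakComposition (decreasing (suc k)) ≡ suc k ∷ []
peakComposition-decreasing zero = refl
peakComposition-decreasing (suc j) rewrite decreasing-no-peaks 2 j (suc (suc j)) ≤-refl =
  cong (λ n → suc n ∷ []) (length-decreasing (suc j))

-- Some permutation (the decreasing one) has peak composition (n).
P-single-positive : ∀ n → 1 ≤ n → 1 ≤ P (n ∷ [])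
P-single-positive (suc k) _ with perms-head (suc k)
... | rest , e = begin
  1                                                   ≡⟨ cong indicator (eqList-complete (peakComposition-decreasing k)) ⟨
  hits c (decreasing (suc k))                         ≤⟨ m≤m+n _ _ ⟩
  hits c (decreasing (suc k)) + sumOver rest (hits c) ≡⟨ cong (λ l → sumOver l (hits c)) e ⟨
  total (suc k) (hits c)                              ≡⟨ P-as-sum c (+-identityʳ (suc k)) ⟨
  P c ∎
  where
  open ≤-Reasoning
  c = suc k ∷ []

-- So a maximal composition c of n ≥ 1 has P(c) ≥ P((n)) ≥ 1.
maximal-positive : ∀ {c} → IsMaximal c → 1 ≤ size c → 1 ≤ P c
maximal-positive {c} max 1≤|c| =
  ≤-trans (P-single-positive (size c) 1≤|c|) (max (size c ∷ []) (1≤|c| ∷ []) (+-identityʳ (size c)))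

not-maximal-by-common-factor : ∀ {c c'} K {A A'} → 1 ≤ size c → IsComposition c' → size c' ≡ size c →
  P c ≡ K * A → P c' ≡ K * A' → A < A' → ¬ IsMaximal c
not-maximal-by-common-factor {c} zero 1≤|c| _ _ Pc _ _ max = 1+n≰n (subst (1 ≤_) Pc (maximal-positive {c} max 1≤|c|))
not-maximal-by-common-factor {c} {c'} K@(suc _) {A} {A'} _ c'-comp |c'| Pc Pc' A<A' max = <-irrefl refl (begin-strict
  P c    ≡⟨ Pc ⟩
  K * A  <⟨ *-monoʳ-< K A<A' ⟩
  K * A' ≡⟨ Pc' ⟨
  P c'   ≤⟨ max c' c'-comp |c'| ⟩
  P c ∎)
  where open ≤-Reasoning

nonempty-size : ∀ {z} → IsComposition z → z ≢ [] → 1 ≤ size z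
nonempty-size [] z≢[] = ⊥-elim (z≢[] refl)
nonempty-size {c ∷ z} (0<c ∷ _) _ = ≤-trans 0<c (m≤m+n c (size z))

size-congʳ : ∀ X {w w'} → size w' ≡ size w → size (X ++ w') ≡ size (X ++ w)
size-congʳ X {w} {w'} e = trans (sum-++ X w') (trans (cong (size X +_) e) (sym (sum-++ X w)))

size-congˡ : ∀ {w w'} Y → size w' ≡ size w → size (w' ++ Y) ≡ size (w ++ Y)
size-congˡ {w} {w'} Y e = trans (sum-++ w' Y) (trans (cong (_+ size Y) e) (sym (sum-++ w Y)))

size-positive : ∀ X z → 1 ≤ size (X ++ 3 ∷ z)
size-positive X z = subst (1 ≤_) (sym (sum-++ X (3 ∷ z))) (≤-trans (s≤s z≤n) (m≤n+m (3 + size z) (size X)))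

-- Replacing the last block z changes P only through P((2) ⊕ z).
lastFactor : List ℕ → ℕ → ℕ
lastFactor X s = ((size X + 3 + s) C suc (size X)) * P (X ++ 1 ∷ [])

P-lastBlock : ∀ {X z} → IsComposition X → IsComposition z → z ≢ [] →
  P (X ++ 3 ∷ z) ≡ lastFactor X (size z) * P (2 ∷ z)
P-lastBlock {X} {z} X-comp z-comp z≢[] =
  trans (P-product X-comp z-comp z≢[]) (sym (*-assoc ((size X + 3 + size z) C suc (size X)) (P (X ++ 1 ∷ [])) (P (2 ∷ z))))

-- Replacing an inner block z changes P only through P((2) ⊕ z ⊕ (1)).
middleFactor : List ℕ → List ℕ → ℕ → ℕ
middleFactor X Y s = lastFactor X (s + (3 + size Y)) * (((2 + s + 3 + size Y) C (3 + s)) * P (2 ∷ Y))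

P-middleBlock : ∀ {X Y z} → IsComposition X → IsComposition Y → Y ≢ [] → IsComposition z →
  P (X ++ 3 ∷ z ++ 3 ∷ Y) ≡ middleFactor X Y (size z) * P (2 ∷ z ++ 1 ∷ [])
P-middleBlock {X} {Y} {z} X-comp Y-comp Y≢[] z-comp = begin
  P (X ++ 3 ∷ z ++ 3 ∷ Y)
    ≡⟨ P-lastBlock X-comp (AllP.++⁺ z-comp (s≤s z≤n ∷ Y-comp)) (z3Y≢[] z) ⟩
  lastFactor X (size (z ++ 3 ∷ Y)) * P (2 ∷ z ++ 3 ∷ Y)
    ≡⟨ cong₂ _*_ (cong (lastFactor X) (sum-++ z (3 ∷ Y))) (P-product {2 ∷ z} {Y} (s≤s z≤n ∷ z-comp) Y-comp Y≢[]) ⟩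
  L * (B * (P (2 ∷ z ++ 1 ∷ []) * P (2 ∷ Y)))
    ≡⟨ solve 4 (λ l b q r → l :* (b :* (q :* r)) := l :* (b :* r) :* q) refl L B (P (2 ∷ z ++ 1 ∷ [])) (P (2 ∷ Y)) ⟩
  middleFactor X Y (size z) * P (2 ∷ z ++ 1 ∷ []) ∎
  where
  open ≡-Reasoning
  L = lastFactor X (size z + (3 + size Y))
  B = (2 + size z + 3 + size Y) C (3 + size z)
  z3Y≢[] : ∀ z → z ++ 3 ∷ Y ≢ []
  z3Y≢[] [] ()
  z3Y≢[] (_ ∷ _) ()

lastBlock-not-maximal : ∀ {X z z'} → IsComposition X → IsComposition z → z ≢ [] → IsComposition z' →
  size z' ≡ size z → P (2 ∷ z) < P (2 ∷ z') → ¬ IsMaximal (X ++ 3 ∷ z)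
lastBlock-not-maximal {X} {z} {z'} X-comp z-comp z≢[] z'-comp |z'| improved =
  not-maximal-by-common-factor {X ++ 3 ∷ z} {X ++ 3 ∷ z'} (lastFactor X (size z)) (size-positive X z)
    (AllP.++⁺ X-comp (s≤s z≤n ∷ z'-comp)) (size-congʳ X (cong (3 +_) |z'|))
    (P-lastBlock X-comp z-comp z≢[])
    (trans (P-lastBlock X-comp z'-comp z'≢[]) (cong (λ s → lastFactor X s * P (2 ∷ z')) |z'|))
    improved
  where
  z'≢[] : z' ≢ []
  z'≢[] refl = 1+n≰n (subst (1 ≤_) (sym |z'|) (nonempty-size z-comp z≢[]))

middleBlock-not-maximal : ∀ {X Y z z'} → IsComposition X → IsComposition Y → Y ≢ [] → IsComposition z →
  IsComposition z' → size z' ≡ size z → P (2 ∷ z ++ 1 ∷ []) < P (2 ∷ z' ++ 1 ∷ []) →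
  ¬ IsMaximal (X ++ 3 ∷ z ++ 3 ∷ Y)
middleBlock-not-maximal {X} {Y} {z} {z'} X-comp Y-comp Y≢[] z-comp z'-comp |z'| improved =
  not-maximal-by-common-factor {X ++ 3 ∷ z ++ 3 ∷ Y} {X ++ 3 ∷ z' ++ 3 ∷ Y} (middleFactor X Y (size z))
    (size-positive X (z ++ 3 ∷ Y))
    (AllP.++⁺ X-comp (s≤s z≤n ∷ AllP.++⁺ z'-comp (s≤s z≤n ∷ Y-comp)))
    (size-congʳ X (cong (3 +_) (size-congˡ {z} {z'} (3 ∷ Y) |z'|)))
    (P-middleBlock X-comp Y-comp Y≢[] z-comp)
    (trans (P-middleBlock X-comp Y-comp Y≢[] z'-comp) (cong (λ s → middleFactor X Y s * P (2 ∷ z' ++ 1 ∷ [])) |z'|))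
    improved

join3-composition : ∀ {m} (cs : Vec (List ℕ) (suc m)) → (∀ j → IsComposition (lookup cs j)) → IsComposition (join3 cs)
join3-composition (c ∷ []) comp = comp zero
join3-composition (c ∷ d ∷ ds) comp = AllP.++⁺ (comp zero) (s≤s z≤n ∷ join3-composition (d ∷ ds) (λ j → comp (suc j)))

join3-nonempty : ∀ {m} (cs : Vec (List ℕ) (suc m)) → lookup cs (fromℕ m) ≢ [] → join3 cs ≢ []
join3-nonempty (c ∷ []) last≢[] = last≢[]
join3-nonempty ([] ∷ d ∷ ds) _ ()
join3-nonempty ((_ ∷ _) ∷ d ∷ ds) _ ()

join3-last : ∀ k → 1 ≤ k → (cs : Vec (List ℕ) (suc k)) → (∀ j → IsComposition (lookup cs j)) →
  Σ (List ℕ) λ X → IsComposition X × (join3 cs ≡ X ++ 3 ∷ lookup cs (fromℕ k))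
join3-last (suc zero) _ (c₀ ∷ c₁ ∷ []) comp = c₀ , comp zero , refl
join3-last (suc (suc k)) _ (c₀ ∷ c₁ ∷ cs) comp with join3-last (suc k) (s≤s z≤n) (c₁ ∷ cs) (λ j → comp (suc j))
... | X , X-comp , e = c₀ ++ 3 ∷ X , AllP.++⁺ (comp zero) (s≤s z≤n ∷ X-comp) ,
  trans (cong (λ t → c₀ ++ 3 ∷ t) e) (sym (++-assoc c₀ (3 ∷ X) _))

join3-middle : ∀ k (cs : Vec (List ℕ) (suc k)) (i : Fin (suc k)) → 1 ≤ toℕ i → toℕ i < k →
  (∀ j → IsComposition (lookup cs j)) → lookup cs (fromℕ k) ≢ [] →
  Σ (List ℕ) λ X → Σ (List ℕ) λ Y → IsComposition X × IsComposition Y × Y ≢ [] ×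
    (join3 cs ≡ X ++ 3 ∷ lookup cs i ++ 3 ∷ Y)
join3-middle (suc (suc k)) (c₀ ∷ c₁ ∷ d ∷ ds) (suc zero) _ _ comp last≢[] =
  c₀ , join3 (d ∷ ds) , comp zero , join3-composition (d ∷ ds) (λ j → comp (suc (suc j))) ,
  join3-nonempty (d ∷ ds) last≢[] , refl
join3-middle (suc (suc k)) (c₀ ∷ c₁ ∷ d ∷ ds) (suc (suc i)) _ (s≤s i<k) comp last≢[]
  with join3-middle (suc k) (c₁ ∷ d ∷ ds) (suc i) (s≤s z≤n) i<k (λ j → comp (suc j)) last≢[]
... | X , Y , X-comp , Y-comp , Y≢[] , e = c₀ ++ 3 ∷ X , Y , AllP.++⁺ (comp zero) (s≤s z≤n ∷ X-comp) , Y-comp , Y≢[] ,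
  trans (cong (λ t → c₀ ++ 3 ∷ t) e) (sym (++-assoc c₀ (3 ∷ X) _))
join3-middle (suc zero) (c₀ ∷ c₁ ∷ []) (suc zero) _ (s≤s ()) _ _

proposition5p3 : (k : ℕ) → 1 ≤ k → (cs : Vec (List ℕ) (suc k)) → (∀ j → IsComposition (lookup cs j)) → lookup cs (fromℕ k) ≢ ε → (b : List ℕ) → IsComposition b → ((Σ (Fin (suc k)) λ i → (1 ≤ toℕ i × toℕ i < k) × (size b ≡ size (lookup cs i)) × (P ((2 ∷ []) ⊕ lookup cs i ⊕ (1 ∷ [])) < P ((2 ∷ []) ⊕ b ⊕ (1 ∷ [])))) ⊎ ((size b ≡ size (lookup cs (fromℕ k))) × (P ((2 ∷ []) ⊕ lookup cs (fromℕ k)) < P ((2 ∷ []) ⊕ b)))) → ¬ IsMaximal (join3 cs)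
proposition5p3 k 1≤k cs comp last≢ε b b-comp (inj₁ (i , (1≤i , i<k) , |b| , improved)) max
  with join3-middle k cs i 1≤i i<k comp last≢ε
... | X , Y , X-comp , Y-comp , Y≢[] , c≡ =
  middleBlock-not-maximal X-comp Y-comp Y≢[] (comp i) b-comp |b| improved (subst IsMaximal c≡ max)
proposition5p3 k 1≤k cs comp last≢ε b b-comp (inj₂ (|b| , improved)) max
  with join3-last k 1≤k cs comp
... | X , X-comp , c≡ =
  lastBlock-not-maximal X-comp (comp (fromℕ k)) last≢ε b-comp |b| improved (subst IsMaximal c≡ max)
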